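{- Let $B=\{b_1,\ldots,b_n\}\subseteq\mathbb{Z}^m$ generate $\mathbb{Z}^m$ as an abelian group, let $A=\{a_1,\ldots,a_n\}\subseteq\mathbb{Z}^{n-m}$ be a Gale dual configuration, grade $S=k[x_1,\ldots,x_n]$ by $\deg x_i=a_i$, and let $M\subseteq S$ be a virtual initial ideal of $J_B$. Let $c\in\mathbb{Z}^n$ be such that $P_c$ is non-empty and $P_c=Q_c$. Then the lattice point $z\in Q_c$ for which $\prod_{i=1}^n x_i^{c_i-b_i\cdot z}\notin M$ (there is exactly one such point) is a vertex of $Q_c$.
   Context: $k$ is a field. $J_B\subseteq S$ is the ideal generated by $\prod_{i:\,u\cdot b_i>0}x_i^{u\cdot b_i}-\prod_{j:\,u\cdot b_j<0}x_j^{ -u\cdot b_j}$, $u\in\mathbb{Z}^m$. Viewing $B$ as the $m\times n$ matrix with columns $b_i$, a Gale dual is $A\subseteq\mathbb{Z}^{n-m}$ such that the integer kernel of the matrix $(a_1,\ldots,a_n)$ is spanned by the rows of $B$. $\mathbb{N}A$ is the monoid generated by $a_1,\ldots,a_n$. A monomial ideal $M$ is a virtual initial ideal of $J_B$ if for every $b\in\mathbb{N}A$ there is exactly one monomial of degree $b$ not in $M$. For $c\in\mathbb{Z}^n$, $P_c=\{x\in\mathbb{R}^m : b_i\cdot x\le c_i,\ i=1,\ldots,n\}$ and $Q_c=\mathrm{conv}(P_c\cap\mathbb{Z}^m)$.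
   Formalization: The polyhedra $P_c$ and $Q_c$ are taken over ℚ^m rather than ℝ^m, so non-emptiness, the equality $P_c=Q_c$ and being a vertex of $Q_c$ refer to rational points only. -}

module Defs where

open import Data.Nat as ℕ using (ℕ; zero; suc; _∸_)
open import Data.Fin using (Fin; zero; suc)
open import Data.Integer as ℤ using (ℤ; +_; ∣_∣)
open import Data.Rational as ℚ using (ℚ; 0ℚ; 1ℚ)
open import Data.Product using (Σ; _×_; ∃)
open import Relation.Binary.PropositionalEquality using (_≡_)
open import Relation.Nullary using (¬_)

ℤ^ : ℕ → Set
ℤ^ d = Fin d → ℤ

ℚ^ : ℕ → Set
ℚ^ d = Fin d → ℚ

-- Exponent vectors of monomials in k[x_1,...,x_n].
ℕ^ : ℕ → Set
ℕ^ d = Fin d → ℕ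

sumℤ : ∀ n → (Fin n → ℤ) → ℤ
sumℤ zero    f = + 0
sumℤ (suc n) f = f zero ℤ.+ sumℤ n (λ i → f (suc i))

sumℚ : ∀ n → (Fin n → ℚ) → ℚ
sumℚ zero    f = 0ℚ
sumℚ (suc n) f = f zero ℚ.+ sumℚ n (λ i → f (suc i))

toℚ : ℤ → ℚ
toℚ z = z ℚ./ 1

_·ℤ_ : ∀ {m} → ℤ^ m → ℤ^ m → ℤ
_·ℤ_ {m} x y = sumℤ m (λ j → x j ℤ.* y j)

_·ℚ_ : ∀ {m} → ℤ^ m → ℚ^ m → ℚ
_·ℚ_ {m} x y = sumℚ m (λ j → toℚ (x j) ℚ.* y j)

Config : ℕ → ℕ → Set
Config n d = Fin n → ℤ^ d

Generates : ∀ {n m} → Config n m → Set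
Generates {n} {m} B =
  ∀ (v : ℤ^ m) → ∃ λ (λs : ℤ^ n) → ∀ j → v j ≡ sumℤ n (λ i → λs i ℤ.* B i j)

-- A ⊆ Z^(n-m) is Gale dual to B: the integer kernel of the matrix (a_1,...,a_n)
-- equals the Z-span of the rows of B (row j of B is (b_1 j, ..., b_n j)).
GaleDual : ∀ {n m} → Config n m → Config n (n ∸ m) → Set
GaleDual {n} {m} B A =
  ∀ (u : ℤ^ n) →
    ((∀ k → sumℤ n (λ i → u i ℤ.* A i k) ≡ + 0)
       → ∃ λ (w : ℤ^ m) → ∀ i → u i ≡ B i ·ℤ w)
  × ((∃ λ (w : ℤ^ m) → ∀ i → u i ≡ B i ·ℤ w)
       → ∀ k → sumℤ n (λ i → u i ℤ.* A i k) ≡ + 0)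

deg : ∀ {n d} → Config n d → ℕ^ n → ℤ^ d
deg {n} A u k = sumℤ n (λ i → + (u i) ℤ.* A i k)

InNA : ∀ {n d} → Config n d → ℤ^ d → Set
InNA {n} A b = ∃ λ (u : ℕ^ n) → ∀ k → deg A u k ≡ b k

-- A monomial ideal of S = k[x_1..x_n], represented (as usual) by the set of
-- exponent vectors of the monomials it contains; it is closed under
-- multiplication by monomials (u ∈ M, u ≤ v componentwise ⇒ v ∈ M).
record MonomialIdeal (n : ℕ) : Set₁ where
  field
    _∈M : ℕ^ n → Set
    closed : ∀ (u v : ℕ^ n) → (∀ i → u i ℕ.≤ v i) → u ∈M → v ∈M
open MonomialIdeal public

-- M is a virtual initial ideal of J_B (for the grading by the Gale dual A):
-- for every b ∈ NA there is exactly one monomial of degree b not in M.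
VirtualInitial : ∀ {n d} → Config n d → MonomialIdeal n → Set
VirtualInitial {n} A M =
  ∀ b → InNA A b →
    ∃ λ (u : ℕ^ n) → ((∀ k → deg A u k ≡ b k) × ¬ (_∈M M u))
      × (∀ (v : ℕ^ n) → (∀ k → deg A v k ≡ b k) → ¬ (_∈M M v) → ∀ i → v i ≡ u i)

InP : ∀ {n m} → Config n m → ℤ^ n → ℚ^ m → Set
InP B c x = ∀ i → (B i ·ℚ x) ℚ.≤ toℚ (c i)

InPℤ : ∀ {n m} → Config n m → ℤ^ n → ℤ^ m → Set
InPℤ B c z = InP B c (λ j → toℚ (z j))

-- Q_c = conv(P_c ∩ Z^m) (rational points): finite convex combinations
InQ : ∀ {n m} → Config n m → ℤ^ n → ℚ^ m → Set
InQ {n} {m} B c x =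
  Σ ℕ λ K → Σ (Fin K → ℤ^ m) λ p → Σ (Fin K → ℚ) λ t →
    (∀ r → InPℤ B c (p r)) × (∀ r → 0ℚ ℚ.≤ t r) × (sumℚ K t ≡ 1ℚ)
    × (∀ j → x j ≡ sumℚ K (λ r → t r ℚ.* toℚ (p r j)))

VertexQ : ∀ {n m} → Config n m → ℤ^ n → ℚ^ m → Set
VertexQ {n} {m} B c z =
  InQ B c z ×
  (∀ (x y : ℚ^ m) (t : ℚ) → InQ B c x → InQ B c y →
     0ℚ ℚ.< t → t ℚ.< 1ℚ →
     (∀ j → z j ≡ t ℚ.* x j ℚ.+ (1ℚ ℚ.- t) ℚ.* y j) →
     ∀ j → x j ≡ y j)

-- exponent vector of ∏ x_i^(c_i - b_i·z) (for z ∈ P_c these are ≥ 0)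
expo : ∀ {n m} → Config n m → ℤ^ n → ℤ^ m → ℕ^ n
expo B c z i = ∣ c i ℤ.- B i ·ℤ z ∣

{-# OPTIONS --safe #-}
-- By Gale duality, two monomials have the same degree exactly when their exponent vectors
-- differ by some B w.  So for a lattice point z₀ of P_c, the standard monomial in the degree
-- of x^(c − B z₀) is x^(c − B z) for a lattice point z of P_c.  No other lattice point y of P_c
-- has its slack c − B y bounded by a standard monomial: the positive and negative parts of
-- (c − B y) − (c − B z) would be standard monomials of the same degree, hence equal, so
-- B y = B z and y = z because B generates ℤ^m.
--
-- If z = t x + (1 − t) x′ with x, x′ ∈ Q_c, every lattice point y with positive weight in x
-- or x′ satisfies c − B y ≤ D (c − B z) for some D, and it suffices to show y = z.  Let
-- N = (1 + D)(1 + n) and let p be the standard point of P_{N c}, with slack u.  Then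
-- p / N ∈ P_c = Q_c is a convex combination of lattice points of P_c, and weighing their
-- slacks by 1 / (u_i + 1) shows that one of them, y′, has N (c − B y′) ≤ n (u + 1).  So
-- c − B y′ ≤ u, hence y′ = z, and then c − B y ≤ u as well, hence y = z.
module Submission where

open import Defs
open import Algebra.Bundles using (CommutativeRing)
open import Data.Nat as ℕ using (ℕ; zero; suc; _∸_)
import Data.Nat.Properties as ℕP
import Data.Nat.Coprimality as Coprime
import Data.Nat.Tactic.RingSolver as ℕ-Solver
open import Data.Fin using (Fin; zero; suc)
open import Data.Integer as ℤ using (ℤ; +_; -[1+_]; +[1+_]; _⊖_)
import Data.Integer.Properties as ℤP
import Data.Integer.Tactic.RingSolver as ℤ-Solver
open import Data.Rational as ℚ using (ℚ; mkℚ; 0ℚ; 1ℚ; 1/_)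
import Data.Rational.Properties as ℚP
open import Data.Rational.Solver using (module +-*-Solver)
open import Data.Product using (_×_; ∃; _,_; proj₁; proj₂)
open import Data.Sum using (inj₁; inj₂)
open import Data.Empty using (⊥-elim)
open import Function using (_∘_)
open import Relation.Nullary using (¬_; yes; no)
open import Relation.Binary.PropositionalEquality as ≡ using (_≡_)

-- Sums and dot products over a commutative ring

-- The sums sumℤ and sumℚ of Defs satisfy the defining recursion of the library's sum,
-- through which the library's summation lemmas are transferred.
module Summation {c ℓ} (R : CommutativeRing c ℓ)
  (∑ : ∀ n → (Fin n → CommutativeRing.Carrier R) → CommutativeRing.Carrier R)
  (∑-zero : ∀ f → ∑ zero f ≡ CommutativeRing.0# R)
  (∑-suc : ∀ n f → ∑ (suc n) f ≡ CommutativeRing._+_ R (f zero) (∑ n (f ∘ suc))) where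

  open CommutativeRing R hiding (zero)
  open import Algebra.Properties.Ring ring using (-‿distribʳ-*; -1*x≈-x)
  import Algebra.Properties.Semiring.Sum semiring as Sum
  open import Algebra.Properties.CommutativeSemigroup *-commutativeSemigroup using (x∙yz≈y∙xz)
  open import Relation.Binary.Reasoning.Setoid setoid

  ∑≡sum : ∀ n f → ∑ n f ≡ Sum.sum f
  ∑≡sum zero    f = ∑-zero f
  ∑≡sum (suc n) f = ≡.trans (∑-suc n f) (≡.cong (λ s → f zero + s) (∑≡sum n (f ∘ suc)))

  ∑-cong : ∀ n {f g : Fin n → Carrier} → (∀ i → f i ≈ g i) → ∑ n f ≈ ∑ n g
  ∑-cong n {f} {g} f≈g = begin
    ∑ n f     ≡⟨ ∑≡sum n f ⟩
    Sum.sum f ≈⟨ Sum.sum-cong-≋ f≈g ⟩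
    Sum.sum g ≡⟨ ∑≡sum n g ⟨
    ∑ n g     ∎

  ∑-distrib-+ : ∀ n (f g : Fin n → Carrier) → ∑ n (λ i → f i + g i) ≈ ∑ n f + ∑ n g
  ∑-distrib-+ n f g = begin
    ∑ n (λ i → f i + g i)     ≡⟨ ∑≡sum n _ ⟩
    Sum.sum (λ i → f i + g i) ≈⟨ Sum.∑-distrib-+ f g ⟩
    Sum.sum f + Sum.sum g     ≡⟨ ≡.cong₂ _+_ (∑≡sum n f) (∑≡sum n g) ⟨
    ∑ n f + ∑ n g             ∎

  *-distribˡ-∑ : ∀ n x (f : Fin n → Carrier) → x * ∑ n f ≈ ∑ n (λ i → x * f i)
  *-distribˡ-∑ n x f = begin
    x * ∑ n f                ≡⟨ ≡.cong (x *_) (∑≡sum n f) ⟩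
    x * Sum.sum f            ≈⟨ Sum.*-distribˡ-sum x f ⟩
    Sum.sum (λ i → x * f i)  ≡⟨ ∑≡sum n _ ⟨
    ∑ n (λ i → x * f i)      ∎

  *-distribʳ-∑ : ∀ n x (f : Fin n → Carrier) → ∑ n f * x ≈ ∑ n (λ i → f i * x)
  *-distribʳ-∑ n x f = begin
    ∑ n f * x                ≡⟨ ≡.cong (_* x) (∑≡sum n f) ⟩
    Sum.sum f * x            ≈⟨ Sum.*-distribʳ-sum x f ⟩
    Sum.sum (λ i → f i * x)  ≡⟨ ∑≡sum n _ ⟨
    ∑ n (λ i → f i * x)      ∎

  -‿distrib-∑ : ∀ n (f : Fin n → Carrier) → - ∑ n f ≈ ∑ n (λ i → - f i)
  -‿distrib-∑ n f = begin
    - ∑ n f                   ≈⟨ -1*x≈-x _ ⟨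
    - 1# * ∑ n f              ≈⟨ *-distribˡ-∑ n (- 1#) f ⟩
    ∑ n (λ i → - 1# * f i)    ≈⟨ ∑-cong n (λ i → -1*x≈-x (f i)) ⟩
    ∑ n (λ i → - f i)         ∎

  ∑-distrib-sub : ∀ n (f g : Fin n → Carrier) → ∑ n (λ i → f i + - g i) ≈ ∑ n f + - ∑ n g
  ∑-distrib-sub n f g = trans (∑-distrib-+ n f _) (+-congˡ (sym (-‿distrib-∑ n g)))

  ∑-comm : ∀ m n (f : Fin m → Fin n → Carrier) →
           ∑ m (λ i → ∑ n (f i)) ≈ ∑ n (λ j → ∑ m (λ i → f i j))
  ∑-comm m n f = begin
    ∑ m (λ i → ∑ n (f i))                 ≡⟨ ≡.trans (∑≡sum m _) (Sum.sum-cong-≗ (λ i → ∑≡sum n (f i))) ⟩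
    Sum.sum (λ i → Sum.sum (f i))         ≈⟨ Sum.∑-comm f ⟩
    Sum.sum (λ j → Sum.sum (λ i → f i j)) ≡⟨ ≡.trans (∑≡sum n _) (Sum.sum-cong-≗ (λ j → ∑≡sum m (λ i → f i j))) ⟨
    ∑ n (λ j → ∑ m (λ i → f i j))         ∎

  ∑-weighted-comm : ∀ K n (μ : Fin K → Carrier) (ω : Fin n → Carrier) (f : Fin K → Fin n → Carrier) →
    ∑ K (λ r → μ r * ∑ n (λ i → ω i * f r i)) ≈ ∑ n (λ i → ω i * ∑ K (λ r → μ r * f r i))
  ∑-weighted-comm K n μ ω f = begin
    ∑ K (λ r → μ r * ∑ n (λ i → ω i * f r i))    ≈⟨ ∑-cong K (λ r → *-distribˡ-∑ n (μ r) _) ⟩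
    ∑ K (λ r → ∑ n (λ i → μ r * (ω i * f r i)))  ≈⟨ ∑-cong K (λ r → ∑-cong n (λ i → x∙yz≈y∙xz (μ r) (ω i) (f r i))) ⟩
    ∑ K (λ r → ∑ n (λ i → ω i * (μ r * f r i)))  ≈⟨ ∑-comm K n _ ⟩
    ∑ n (λ i → ∑ K (λ r → ω i * (μ r * f r i)))  ≈⟨ ∑-cong n (λ i → *-distribˡ-∑ K (ω i) _) ⟨
    ∑ n (λ i → ω i * ∑ K (λ r → μ r * f r i))    ∎

  infix 7 _·_
  _·_ : ∀ {n} → (Fin n → Carrier) → (Fin n → Carrier) → Carrier
  _·_ {n} x y = ∑ n (λ j → x j * y j)

  ·-comm : ∀ {n} (x y : Fin n → Carrier) → x · y ≈ y · x
  ·-comm {n} x y = ∑-cong n (λ j → *-comm (x j) (y j))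

  ·-distribˡ-+ : ∀ {n} (a x y : Fin n → Carrier) → a · (λ j → x j + y j) ≈ a · x + a · y
  ·-distribˡ-+ {n} a x y = trans (∑-cong n (λ j → distribˡ (a j) (x j) (y j))) (∑-distrib-+ n _ _)

  ·-distribˡ-sub : ∀ {n} (a x y : Fin n → Carrier) → a · (λ j → x j + - y j) ≈ a · x + - (a · y)
  ·-distribˡ-sub {n} a x y = begin
    a · (λ j → x j + - y j)                  ≈⟨ ∑-cong n (λ j → trans (distribˡ (a j) (x j) (- y j)) (+-congˡ (sym (-‿distribʳ-* (a j) (y j))))) ⟩
    ∑ n (λ j → a j * x j + - (a j * y j))    ≈⟨ ∑-distrib-+ n _ _ ⟩
    a · x + ∑ n (λ j → - (a j * y j))        ≈⟨ +-congˡ (-‿distrib-∑ n _) ⟨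
    a · x + - (a · y)                        ∎

  ·-distribʳ-sub : ∀ {n} (x y a : Fin n → Carrier) → (λ j → x j + - y j) · a ≈ x · a + - (y · a)
  ·-distribʳ-sub x y a = trans (·-comm _ a) (trans (·-distribˡ-sub a x y) (+-cong (·-comm a x) (-‿cong (·-comm a y))))

  ·-*ʳ : ∀ {n} k (a x : Fin n → Carrier) → a · (λ j → k * x j) ≈ k * (a · x)
  ·-*ʳ {n} k a x = begin
    a · (λ j → k * x j)         ≈⟨ ∑-cong n (λ j → x∙yz≈y∙xz (a j) k (x j)) ⟩
    ∑ n (λ j → k * (a j * x j)) ≈⟨ *-distribˡ-∑ n k _ ⟨
    k * (a · x)                 ∎

  ·-∑ʳ : ∀ {n} K (a : Fin n → Carrier) (f : Fin K → Fin n → Carrier) →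
         a · (λ j → ∑ K (λ r → f r j)) ≈ ∑ K (λ r → a · f r)
  ·-∑ʳ {n} K a f = begin
    a · (λ j → ∑ K (λ r → f r j))        ≈⟨ ∑-cong n (λ j → *-distribˡ-∑ K (a j) _) ⟩
    ∑ n (λ j → ∑ K (λ r → a j * f r j))  ≈⟨ ∑-comm n K _ ⟩
    ∑ K (λ r → a · f r)                  ∎

  ·-combinationʳ : ∀ {n} K (a : Fin n → Carrier) (α : Fin K → Carrier) (p : Fin K → Fin n → Carrier) →
                   a · (λ j → ∑ K (λ r → α r * p r j)) ≈ ∑ K (λ r → α r * (a · p r))
  ·-combinationʳ K a α p = trans (·-∑ʳ K a _) (∑-cong K (λ r → ·-*ʳ (α r) a (p r)))

  ·-combinationˡ : ∀ {n} K (α : Fin K → Carrier) (p : Fin K → Fin n → Carrier) (a : Fin n → Carrier) →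
                   (λ j → ∑ K (λ r → α r * p r j)) · a ≈ ∑ K (λ r → α r * (p r · a))
  ·-combinationˡ K α p a =
    trans (·-comm _ a) (trans (·-combinationʳ K a α p) (∑-cong K (λ r → *-congˡ (·-comm a (p r)))))

  basis : ∀ {n} → Fin n → Fin n → Carrier
  basis zero    zero    = 1#
  basis zero    (suc _) = 0#
  basis (suc _) zero    = 0#
  basis (suc i) (suc j) = basis i j

  basis-· : ∀ {n} (i : Fin n) (x : Fin n → Carrier) → basis i · x ≈ x i
  basis-· {suc n} zero x = begin
    basis zero · x                          ≡⟨ ∑-suc n _ ⟩
    1# * x zero + ∑ n (λ j → 0# * x (suc j)) ≈⟨ +-cong (*-identityˡ (x zero)) (∑-cong n (λ j → zeroˡ (x (suc j)))) ⟩
    x zero + ∑ n (λ _ → 0#)                 ≈⟨ +-congˡ (reflexive (∑≡sum n (λ _ → 0#))) ⟩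
    x zero + Sum.sum {n} (λ _ → 0#)         ≈⟨ +-congˡ (Sum.sum-replicate-zero n) ⟩
    x zero + 0#                             ≈⟨ +-identityʳ (x zero) ⟩
    x zero                                  ∎
  basis-· {suc n} (suc i) x = begin
    basis (suc i) · x                       ≡⟨ ∑-suc n _ ⟩
    0# * x zero + basis i · (x ∘ suc)       ≈⟨ +-cong (zeroˡ (x zero)) (basis-· i (x ∘ suc)) ⟩
    0# + x (suc i)                          ≈⟨ +-identityˡ (x (suc i)) ⟩
    x (suc i)                               ∎

open ≡ using (refl; sym; trans; cong; cong₂; subst; subst₂; module ≡-Reasoning)

module ℤ∑ = Summation ℤP.+-*-commutativeRing sumℤ (λ _ → refl) (λ _ _ → refl)
module ℚ∑ = Summation ℚP.+-*-commutativeRing sumℚ (λ _ → refl) (λ _ _ → refl)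

m*[1+n]≤n*[1+o]⇒m≤o : ∀ m n o → m ℕ.* suc n ℕ.≤ n ℕ.* suc o → m ℕ.≤ o
m*[1+n]≤n*[1+o]⇒m≤o m n o m[1+n]≤n[1+o] = ℕP.≮⇒≥ λ o<m → ℕP.<⇒≱ (begin-strict
  n ℕ.* suc o        <⟨ ℕP.m<n+m (n ℕ.* suc o) (ℕ.s≤s ℕ.z≤n) ⟩
  suc n ℕ.* suc o    ≤⟨ ℕP.*-monoʳ-≤ (suc n) o<m ⟩
  suc n ℕ.* m        ≡⟨ ℕP.*-comm (suc n) m ⟩
  m ℕ.* suc n        ∎) m[1+n]≤n[1+o]
  where open ℕP.≤-Reasoning

m≤d*e⇒m*[1+n]≤e*[[1+d]*[1+n]] : ∀ m d e n → m ℕ.≤ d ℕ.* e → m ℕ.* suc n ℕ.≤ e ℕ.* (suc d ℕ.* suc n)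
m≤d*e⇒m*[1+n]≤e*[[1+d]*[1+n]] m d e n m≤de = begin
  m ℕ.* suc n                 ≤⟨ ℕP.*-monoˡ-≤ (suc n) (ℕP.≤-trans m≤de (ℕP.*-monoˡ-≤ e (ℕP.n≤1+n d))) ⟩
  suc d ℕ.* e ℕ.* suc n       ≡⟨ regroup (suc d) e (suc n) ⟩
  e ℕ.* (suc d ℕ.* suc n)     ∎
  where
  open ℕP.≤-Reasoning
  regroup : ∀ d e n → d ℕ.* e ℕ.* n ≡ e ℕ.* (d ℕ.* n)
  regroup = ℕ-Solver.solve-∀

[m∸n]⊖[n∸m]≡m⊖n : ∀ m n → (m ∸ n) ⊖ (n ∸ m) ≡ m ⊖ n
[m∸n]⊖[n∸m]≡m⊖n zero    zero    = refl
[m∸n]⊖[n∸m]≡m⊖n zero    (suc n) = refl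
[m∸n]⊖[n∸m]≡m⊖n (suc m) zero    = refl
[m∸n]⊖[n∸m]≡m⊖n (suc m) (suc n) = trans ([m∸n]⊖[n∸m]≡m⊖n m n) (sym (ℤP.[1+m]⊖[1+n]≡m⊖n m n))

[m∸n]-[n∸m]≡m-n : ∀ m n → + (m ∸ n) ℤ.- + (n ∸ m) ≡ + m ℤ.- + n
[m∸n]-[n∸m]≡m-n m n = trans (ℤP.m-n≡m⊖n (m ∸ n) (n ∸ m)) (trans ([m∸n]⊖[n∸m]≡m⊖n m n) (sym (ℤP.m-n≡m⊖n m n)))

*-nonNeg : ∀ {p q} → 0ℚ ℚ.≤ p → 0ℚ ℚ.≤ q → 0ℚ ℚ.≤ p ℚ.* q
*-nonNeg {p} {q} 0≤p 0≤q =
  ℚP.nonNegative⁻¹ _ {{ℚP.nonNeg*nonNeg⇒nonNeg p {{ℚ.nonNegative 0≤p}} q {{ℚ.nonNegative 0≤q}}}}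

*-monoˡ-≤-nonNeg : ∀ {r p q} → 0ℚ ℚ.≤ r → p ℚ.≤ q → r ℚ.* p ℚ.≤ r ℚ.* q
*-monoˡ-≤-nonNeg {r} 0≤r = ℚP.*-monoˡ-≤-nonNeg r {{ℚ.nonNegative 0≤r}}

*-monoʳ-≤-nonNeg : ∀ {r p q} → 0ℚ ℚ.≤ r → p ℚ.≤ q → p ℚ.* r ℚ.≤ q ℚ.* r
*-monoʳ-≤-nonNeg {r} 0≤r = ℚP.*-monoʳ-≤-nonNeg r {{ℚ.nonNegative 0≤r}}

*-pos : ∀ {p q} → 0ℚ ℚ.< p → 0ℚ ℚ.< q → 0ℚ ℚ.< p ℚ.* q
*-pos {p} {q} 0<p 0<q = ℚP.positive⁻¹ _ {{ℚP.pos*pos⇒pos p {{ℚ.positive 0<p}} q {{ℚ.positive 0<q}}}}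

p≤p+q : ∀ p {q} → 0ℚ ℚ.≤ q → p ℚ.≤ p ℚ.+ q
p≤p+q p {q} 0≤q = ℚP.≤-trans (ℚP.≤-reflexive (sym (ℚP.+-identityʳ p))) (ℚP.+-monoʳ-≤ p 0≤q)

q≤p+q : ∀ {p} q → 0ℚ ℚ.≤ p → q ℚ.≤ p ℚ.+ q
q≤p+q {p} q 0≤p = ℚP.≤-trans (ℚP.≤-reflexive (sym (ℚP.+-identityˡ q))) (ℚP.+-monoˡ-≤ q 0≤p)

0≤q-p⇒p≤q : ∀ {p q} → 0ℚ ℚ.≤ q ℚ.- p → p ℚ.≤ q
0≤q-p⇒p≤q {p} {q} 0≤q-p = begin
  p                    ≡⟨ ℚP.+-identityˡ p ⟨
  0ℚ ℚ.+ p             ≤⟨ ℚP.+-monoˡ-≤ p 0≤q-p ⟩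
  q ℚ.- p ℚ.+ p        ≡⟨ solve 2 (λ p q → q :- p :+ p := q) refl p q ⟩
  q                    ∎
  where open ℚP.≤-Reasoning
        open +-*-Solver

p≤q⇒0≤q-p : ∀ {p q} → p ℚ.≤ q → 0ℚ ℚ.≤ q ℚ.- p
p≤q⇒0≤q-p {p} {q} p≤q = begin
  0ℚ                   ≡⟨ ℚP.+-inverseʳ p ⟨
  p ℚ.- p              ≤⟨ ℚP.+-monoˡ-≤ (ℚ.- p) p≤q ⟩
  q ℚ.- p              ∎
  where open ℚP.≤-Reasoning

p<q⇒0<q-p : ∀ {p q} → p ℚ.< q → 0ℚ ℚ.< q ℚ.- p
p<q⇒0<q-p {p} {q} p<q = ℚP.<-respˡ-≡ (ℚP.+-inverseʳ p) (ℚP.+-monoˡ-< (ℚ.- p) p<q)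

-- toℚ z = z / 1 normalises through a gcd, which does not compute on variables; fromℤ
-- builds the same rational directly, so that ℚ arithmetic on it reduces.
fromℤ : ℤ → ℚ
fromℤ z = mkℚ z 0 (Coprime.sym (Coprime.1-coprimeTo ℤ.∣ z ∣))

toℚ≡fromℤ : ∀ z → toℚ z ≡ fromℤ z
toℚ≡fromℤ (+ n)    = ℚP.normalize-coprime (Coprime.sym (Coprime.1-coprimeTo n))
toℚ≡fromℤ -[1+ n ] = cong ℚ.-_ (ℚP.normalize-coprime (Coprime.sym (Coprime.1-coprimeTo (suc n))))

toℚ-+ : ∀ a b → toℚ (a ℤ.+ b) ≡ toℚ a ℚ.+ toℚ b
toℚ-+ a b = begin
  toℚ (a ℤ.+ b)                         ≡⟨ cong toℚ (cong₂ ℤ._+_ (ℤP.*-identityʳ a) (ℤP.*-identityʳ b)) ⟨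
  toℚ (a ℤ.* + 1 ℤ.+ b ℤ.* + 1)         ≡⟨⟩
  fromℤ a ℚ.+ fromℤ b                   ≡⟨ cong₂ ℚ._+_ (toℚ≡fromℤ a) (toℚ≡fromℤ b) ⟨
  toℚ a ℚ.+ toℚ b                       ∎
  where open ≡-Reasoning

toℚ-* : ∀ a b → toℚ (a ℤ.* b) ≡ toℚ a ℚ.* toℚ b
toℚ-* a b = sym (cong₂ ℚ._*_ (toℚ≡fromℤ a) (toℚ≡fromℤ b))

fromℤ-neg : ∀ a → fromℤ (ℤ.- a) ≡ ℚ.- fromℤ a
fromℤ-neg (+ zero) = refl
fromℤ-neg +[1+ n ] = refl
fromℤ-neg -[1+ n ] = refl

toℚ-neg : ∀ a → toℚ (ℤ.- a) ≡ ℚ.- toℚ a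
toℚ-neg a = trans (toℚ≡fromℤ (ℤ.- a)) (trans (fromℤ-neg a) (cong ℚ.-_ (sym (toℚ≡fromℤ a))))

toℚ-sub : ∀ a b → toℚ (a ℤ.- b) ≡ toℚ a ℚ.- toℚ b
toℚ-sub a b = trans (toℚ-+ a (ℤ.- b)) (cong (toℚ a ℚ.+_) (toℚ-neg b))

toℚ-mono-≤ : ∀ {a b} → a ℤ.≤ b → toℚ a ℚ.≤ toℚ b
toℚ-mono-≤ {a} {b} a≤b = subst₂ ℚ._≤_ (sym (toℚ≡fromℤ a)) (sym (toℚ≡fromℤ b))
  (ℚ.*≤* (subst₂ ℤ._≤_ (sym (ℤP.*-identityʳ a)) (sym (ℤP.*-identityʳ b)) a≤b))

toℚ-cancel-≤ : ∀ {a b} → toℚ a ℚ.≤ toℚ b → a ℤ.≤ b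
toℚ-cancel-≤ {a} {b} le with subst₂ ℚ._≤_ (toℚ≡fromℤ a) (toℚ≡fromℤ b) le
... | ℚ.*≤* a*1≤b*1 = subst₂ ℤ._≤_ (ℤP.*-identityʳ a) (ℤP.*-identityʳ b) a*1≤b*1

toℚ-∑ : ∀ n (f : Fin n → ℤ) → toℚ (sumℤ n f) ≡ sumℚ n (toℚ ∘ f)
toℚ-∑ zero    f = refl
toℚ-∑ (suc n) f = trans (toℚ-+ (f zero) _) (cong (toℚ (f zero) ℚ.+_) (toℚ-∑ n (f ∘ suc)))

toℚ-· : ∀ {m} (b z : ℤ^ m) → toℚ (b ·ℤ z) ≡ b ·ℚ (toℚ ∘ z)
toℚ-· {m} b z = trans (toℚ-∑ m _) (ℚ∑.∑-cong m (λ j → toℚ-* (b j) (z j)))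

toℚ-ℕ-* : ∀ m n → toℚ (+ (m ℕ.* n)) ≡ toℚ (+ m) ℚ.* toℚ (+ n)
toℚ-ℕ-* m n = trans (cong toℚ (ℤP.pos-* m n)) (toℚ-* (+ m) (+ n))

toℚ-ℕ-cancel-≤ : ∀ {m n} → toℚ (+ m) ℚ.≤ toℚ (+ n) → m ℕ.≤ n
toℚ-ℕ-cancel-≤ {m} {n} le = ℤP.drop‿+≤+ (toℚ-cancel-≤ {+ m} {+ n} le)

0≤toℚ-ℕ : ∀ n → 0ℚ ℚ.≤ toℚ (+ n)
0≤toℚ-ℕ n = toℚ-mono-≤ {+ 0} {+ n} (ℤ.+≤+ ℕ.z≤n)

1/suc : ℕ → ℚ
1/suc k = 1/ fromℤ (+ suc k)

1/suc-inverse : ∀ k → 1/suc k ℚ.* toℚ (+ suc k) ≡ 1ℚ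
1/suc-inverse k = trans (cong (1/suc k ℚ.*_) (toℚ≡fromℤ (+ suc k))) (ℚP.*-inverseˡ (fromℤ (+ suc k)))

0≤1/suc : ∀ k → 0ℚ ℚ.≤ 1/suc k
0≤1/suc k = ℚ.*≤* (ℤ.+≤+ ℕ.z≤n)

m/[1+n]≤o/[1+p]⇒m*[1+p]≤o*[1+n] : ∀ m n o p →
  1/suc n ℚ.* toℚ (+ m) ℚ.≤ 1/suc p ℚ.* toℚ (+ o) → m ℕ.* suc p ℕ.≤ o ℕ.* suc n
m/[1+n]≤o/[1+p]⇒m*[1+p]≤o*[1+n] m n o p m/[1+n]≤o/[1+p] = toℚ-ℕ-cancel-≤ (begin
  toℚ (+ (m ℕ.* suc p))
    ≡⟨ toℚ-ℕ-* m (suc p) ⟩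
  M ℚ.* P₁
    ≡⟨ cong (ℚ._* P₁) (ℚP.*-identityʳ M) ⟨
  M ℚ.* 1ℚ ℚ.* P₁
    ≡⟨ cong (λ a → M ℚ.* a ℚ.* P₁) (1/suc-inverse n) ⟨
  M ℚ.* (1/suc n ℚ.* N₁) ℚ.* P₁
    ≡⟨ solve 4 (λ M a N P → M :* (a :* N) :* P := a :* M :* N :* P) refl M (1/suc n) N₁ P₁ ⟩
  1/suc n ℚ.* M ℚ.* N₁ ℚ.* P₁
    ≤⟨ *-monoʳ-≤-nonNeg (0≤toℚ-ℕ (suc p)) (*-monoʳ-≤-nonNeg (0≤toℚ-ℕ (suc n)) m/[1+n]≤o/[1+p]) ⟩
  1/suc p ℚ.* O ℚ.* N₁ ℚ.* P₁
    ≡⟨ solve 4 (λ b O N P → b :* O :* N :* P := b :* P :* (O :* N)) refl (1/suc p) O N₁ P₁ ⟩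
  1/suc p ℚ.* P₁ ℚ.* (O ℚ.* N₁)
    ≡⟨ cong (ℚ._* (O ℚ.* N₁)) (1/suc-inverse p) ⟩
  1ℚ ℚ.* (O ℚ.* N₁)
    ≡⟨ ℚP.*-identityˡ (O ℚ.* N₁) ⟩
  O ℚ.* N₁
    ≡⟨ toℚ-ℕ-* o (suc n) ⟨
  toℚ (+ (o ℕ.* suc n))
    ∎)
  where
  open ℚP.≤-Reasoning
  open +-*-Solver
  M = toℚ (+ m)
  O = toℚ (+ o)
  N₁ = toℚ (+ suc n)
  P₁ = toℚ (+ suc p)

archimedean : ∀ q → 0ℚ ℚ.< q → ∃ λ D → 1ℚ ℚ.≤ toℚ (+ D) ℚ.* q
archimedean (mkℚ (+ 0)    _ _) 0<q with ℚ.positive 0<q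
... | ()
archimedean (mkℚ -[1+ _ ] _ _) 0<q with ℚ.positive 0<q
... | ()
archimedean (mkℚ +[1+ a ] d c) _ = suc d , (begin
  1ℚ                               ≡⟨ 1/suc-inverse d ⟨
  1/suc d ℚ.* toℚ (+ suc d)        ≡⟨ ℚP.*-comm (1/suc d) (toℚ (+ suc d)) ⟩
  toℚ (+ suc d) ℚ.* 1/suc d        ≤⟨ *-monoˡ-≤-nonNeg {toℚ (+ suc d)} {1/suc d} {mkℚ +[1+ a ] d c} (0≤toℚ-ℕ (suc d))
                                        (ℚ.*≤* (ℤP.*-monoʳ-≤-nonNeg (+ suc d) {+ 1} {+[1+ a ]} (ℤ.+≤+ (ℕ.s≤s ℕ.z≤n)))) ⟩
  toℚ (+ suc d) ℚ.* mkℚ +[1+ a ] d c ∎)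
  where open ℚP.≤-Reasoning

-- Convex combinations of rationals

∑-mono-≤ : ∀ n {f g : Fin n → ℚ} → (∀ i → f i ℚ.≤ g i) → sumℚ n f ℚ.≤ sumℚ n g
∑-mono-≤ zero    f≤g = ℚP.≤-refl
∑-mono-≤ (suc n) f≤g = ℚP.+-mono-≤ (f≤g zero) (∑-mono-≤ n (f≤g ∘ suc))

∑-nonNeg : ∀ n {f : Fin n → ℚ} → (∀ i → 0ℚ ℚ.≤ f i) → 0ℚ ℚ.≤ sumℚ n f
∑-nonNeg zero    0≤f = ℚP.≤-refl
∑-nonNeg (suc n) 0≤f = ℚP.+-mono-≤ (0≤f zero) (∑-nonNeg n (0≤f ∘ suc))

term≤∑ : ∀ n {f : Fin n → ℚ} → (∀ i → 0ℚ ℚ.≤ f i) → ∀ i → f i ℚ.≤ sumℚ n f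
term≤∑ (suc n) {f} 0≤f zero = begin
  f zero                ≡⟨ ℚP.+-identityʳ (f zero) ⟨
  f zero ℚ.+ 0ℚ         ≤⟨ ℚP.+-monoʳ-≤ (f zero) (∑-nonNeg n (0≤f ∘ suc)) ⟩
  sumℚ (suc n) f        ∎
  where open ℚP.≤-Reasoning
term≤∑ (suc n) {f} 0≤f (suc i) = begin
  f (suc i)             ≡⟨ ℚP.+-identityˡ (f (suc i)) ⟨
  0ℚ ℚ.+ f (suc i)      ≤⟨ ℚP.+-mono-≤ (0≤f zero) (term≤∑ n (0≤f ∘ suc) i) ⟩
  sumℚ (suc n) f        ∎
  where open ℚP.≤-Reasoning

∑[1ℚ]≡n : ∀ n → sumℚ n (λ _ → 1ℚ) ≡ toℚ (+ n)
∑[1ℚ]≡n zero    = refl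
∑[1ℚ]≡n (suc n) = trans (cong (1ℚ ℚ.+_) (∑[1ℚ]≡n n)) (sym (toℚ-+ (+ 1) (+ n)))

argmin : ∀ K (H : Fin (suc K) → ℚ) → ∃ λ r → ∀ s → H r ℚ.≤ H s
argmin zero    H = zero , λ { zero → ℚP.≤-refl }
argmin (suc K) H with argmin K (H ∘ suc)
... | r , min with ℚP.≤-total (H zero) (H (suc r))
...   | inj₁ H0≤ = zero  , λ { zero → ℚP.≤-refl ; (suc s) → ℚP.≤-trans H0≤ (min s) }
...   | inj₂ Hr≤ = suc r , λ { zero → Hr≤ ; (suc s) → min s }

min≤average : ∀ K (μ H : Fin K → ℚ) → (∀ r → 0ℚ ℚ.≤ μ r) → sumℚ K μ ≡ 1ℚ →
              ∃ λ r → H r ℚ.≤ sumℚ K (λ s → μ s ℚ.* H s)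
min≤average zero    μ H 0≤μ ∑μ≡1 = ⊥-elim (ℚP.1≢0 (sym ∑μ≡1))
min≤average (suc K) μ H 0≤μ ∑μ≡1 with argmin K H
... | r , min = r , (begin
  H r                                    ≡⟨ ℚP.*-identityˡ (H r) ⟨
  1ℚ ℚ.* H r                             ≡⟨ cong (ℚ._* H r) ∑μ≡1 ⟨
  sumℚ (suc K) μ ℚ.* H r                 ≡⟨ ℚ∑.*-distribʳ-∑ (suc K) (H r) μ ⟩
  sumℚ (suc K) (λ s → μ s ℚ.* H r)       ≤⟨ ∑-mono-≤ (suc K) (λ s → *-monoˡ-≤-nonNeg (0≤μ s) (min s)) ⟩
  sumℚ (suc K) (λ s → μ s ℚ.* H s)       ∎)
  where open ℚP.≤-Reasoning

∑-concentrated : ∀ K (μ f : Fin K → ℚ) w → (∀ r → 0ℚ ℚ.≤ μ r) → (∀ r → 0ℚ ℚ.< μ r → f r ≡ w) →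
                 sumℚ K (λ r → μ r ℚ.* f r) ≡ sumℚ K μ ℚ.* w
∑-concentrated K μ f w 0≤μ f≡w = trans (ℚ∑.∑-cong K term) (sym (ℚ∑.*-distribʳ-∑ K w μ))
  where
  term : ∀ r → μ r ℚ.* f r ≡ μ r ℚ.* w
  term r with 0ℚ ℚP.<? μ r
  ... | yes 0<μ = cong (μ r ℚ.*_) (f≡w r 0<μ)
  ... | no  0≮μ = begin
    μ r ℚ.* f r  ≡⟨ cong (ℚ._* f r) μ≡0 ⟩
    0ℚ ℚ.* f r   ≡⟨ ℚP.*-zeroˡ (f r) ⟩
    0ℚ           ≡⟨ ℚP.*-zeroˡ w ⟨
    0ℚ ℚ.* w     ≡⟨ cong (ℚ._* w) μ≡0 ⟨
    μ r ℚ.* w    ∎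
    where
    open ≡-Reasoning
    μ≡0 : μ r ≡ 0ℚ
    μ≡0 = ℚP.≤-antisym (ℚP.≮⇒≥ 0≮μ) (0≤μ r)

-- Take r minimising H r = Σᵢ T r i / (u i + 1); then H r is at most the μ-average of H,
-- which is Σᵢ (u i / (N + 1)) / (u i + 1) ≤ n / (N + 1).
small-point-of-convex-combination : ∀ {K} n N (μ : Fin K → ℚ) (T : Fin K → ℕ^ n) (u : ℕ^ n) →
  (∀ r → 0ℚ ℚ.≤ μ r) → sumℚ K μ ≡ 1ℚ →
  (∀ i → sumℚ K (λ r → μ r ℚ.* toℚ (+ T r i)) ≡ 1/suc N ℚ.* toℚ (+ u i)) →
  ∃ λ r → ∀ i → T r i ℕ.* suc N ℕ.≤ n ℕ.* suc (u i)
small-point-of-convex-combination {K} n N μ T u 0≤μ ∑μ≡1 ∑μT≡u/N = r , bound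
  where
  ν = 1/suc N
  ω : Fin n → ℚ
  ω i = 1/suc (u i)
  H : Fin K → ℚ
  H r = sumℚ n (λ i → ω i ℚ.* toℚ (+ T r i))
  ∑μH≡ : sumℚ K (λ r → μ r ℚ.* H r) ≡ ν ℚ.* sumℚ n (λ i → ω i ℚ.* toℚ (+ u i))
  ∑μH≡ = begin
    sumℚ K (λ r → μ r ℚ.* H r)                        ≡⟨ ℚ∑.∑-weighted-comm K n μ ω (λ r i → toℚ (+ T r i)) ⟩
    sumℚ n (λ i → ω i ℚ.* sumℚ K (λ r → μ r ℚ.* toℚ (+ T r i)))
                                                      ≡⟨ ℚ∑.∑-cong n (λ i → cong (ω i ℚ.*_) (∑μT≡u/N i)) ⟩
    sumℚ n (λ i → ω i ℚ.* (ν ℚ.* toℚ (+ u i)))        ≡⟨ ℚ∑.·-*ʳ ν ω (λ i → toℚ (+ u i)) ⟩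
    ν ℚ.* sumℚ n (λ i → ω i ℚ.* toℚ (+ u i))          ∎
    where open ≡-Reasoning
  ω-u≤1 : ∀ i → ω i ℚ.* toℚ (+ u i) ℚ.≤ 1ℚ
  ω-u≤1 i = begin
    ω i ℚ.* toℚ (+ u i)          ≤⟨ *-monoˡ-≤-nonNeg (0≤1/suc (u i)) (toℚ-mono-≤ (ℤ.+≤+ (ℕP.n≤1+n (u i)))) ⟩
    ω i ℚ.* toℚ (+ suc (u i))    ≡⟨ 1/suc-inverse (u i) ⟩
    1ℚ                           ∎
    where open ℚP.≤-Reasoning
  r = proj₁ (min≤average K μ H 0≤μ ∑μ≡1)
  H-r≤n/N : H r ℚ.≤ ν ℚ.* toℚ (+ n)
  H-r≤n/N = begin
    H r                                          ≤⟨ proj₂ (min≤average K μ H 0≤μ ∑μ≡1) ⟩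
    sumℚ K (λ r → μ r ℚ.* H r)                   ≡⟨ ∑μH≡ ⟩
    ν ℚ.* sumℚ n (λ i → ω i ℚ.* toℚ (+ u i))     ≤⟨ *-monoˡ-≤-nonNeg (0≤1/suc N) (∑-mono-≤ n ω-u≤1) ⟩
    ν ℚ.* sumℚ n (λ _ → 1ℚ)                      ≡⟨ cong (ν ℚ.*_) (∑[1ℚ]≡n n) ⟩
    ν ℚ.* toℚ (+ n)                              ∎
    where open ℚP.≤-Reasoning
  bound : ∀ i → T r i ℕ.* suc N ℕ.≤ n ℕ.* suc (u i)
  bound i = m/[1+n]≤o/[1+p]⇒m*[1+p]≤o*[1+n] (T r i) (u i) n N (ℚP.≤-trans ω-T≤H-r H-r≤n/N)
    where
    ω-T≤H-r : ω i ℚ.* toℚ (+ T r i) ℚ.≤ H r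
    ω-T≤H-r = term≤∑ n (λ i → *-nonNeg (0≤1/suc (u i)) (0≤toℚ-ℕ (T r i))) i

-- Slack vectors and Gale duality

slack : ∀ {n m} → Config n m → ℤ^ n → ℤ^ m → ℤ^ n
slack B c z i = c i ℤ.- B i ·ℤ z

slackℚ : ∀ {n m} → Config n m → ℤ^ n → ℚ^ m → ℚ^ n
slackℚ B c x i = toℚ (c i) ℚ.- B i ·ℚ x

module _ {n m} (B : Config n m) (c : ℤ^ n) where

  InP⇒0≤slackℚ : ∀ x → InP B c x → ∀ i → 0ℚ ℚ.≤ slackℚ B c x i
  InP⇒0≤slackℚ x x∈P i = p≤q⇒0≤q-p (x∈P i)

  0≤slackℚ⇒InP : ∀ x → (∀ i → 0ℚ ℚ.≤ slackℚ B c x i) → InP B c x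
  0≤slackℚ⇒InP x 0≤slack i = 0≤q-p⇒p≤q (0≤slack i)

  slackℚ-toℚ : ∀ z i → slackℚ B c (toℚ ∘ z) i ≡ toℚ (slack B c z i)
  slackℚ-toℚ z i = sym (trans (toℚ-sub (c i) (B i ·ℤ z)) (cong (λ a → toℚ (c i) ℚ.- a) (toℚ-· (B i) z)))

  InPℤ⇒0≤slack : ∀ z → InPℤ B c z → ∀ i → + 0 ℤ.≤ slack B c z i
  InPℤ⇒0≤slack z z∈P i = toℚ-cancel-≤ (subst (0ℚ ℚ.≤_) (slackℚ-toℚ z i) (InP⇒0≤slackℚ (toℚ ∘ z) z∈P i))

  0≤slack⇒InPℤ : ∀ z → (∀ i → + 0 ℤ.≤ slack B c z i) → InPℤ B c z
  0≤slack⇒InPℤ z 0≤slack = 0≤slackℚ⇒InP (toℚ ∘ z) (λ i →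
    subst (0ℚ ℚ.≤_) (sym (slackℚ-toℚ z i)) (toℚ-mono-≤ (0≤slack i)))

  expo≡slack : ∀ z → InPℤ B c z → ∀ i → + expo B c z i ≡ slack B c z i
  expo≡slack z z∈P i = ℤP.0≤i⇒+∣i∣≡i (InPℤ⇒0≤slack z z∈P i)

  slackℚ-convex : ∀ {K} (α : Fin K → ℚ) (p : Fin K → ℤ^ m) {x} → sumℚ K α ≡ 1ℚ →
                  (∀ j → x j ≡ sumℚ K (λ r → α r ℚ.* toℚ (p r j))) →
                  ∀ i → slackℚ B c x i ≡ sumℚ K (λ r → α r ℚ.* toℚ (slack B c (p r) i))
  slackℚ-convex {K} α p {x} ∑α≡1 x≡ i = begin
    C ℚ.- B i ·ℚ x
      ≡⟨ cong₂ ℚ._-_ (trans (sym (ℚP.*-identityˡ C)) (cong (ℚ._* C) (sym ∑α≡1)))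
                     (ℚ∑.∑-cong m (λ j → cong (toℚ (B i j) ℚ.*_) (x≡ j))) ⟩
    sumℚ K α ℚ.* C ℚ.- b ℚ∑.· (λ j → sumℚ K (λ r → α r ℚ.* toℚ (p r j)))
      ≡⟨ cong₂ ℚ._-_ (ℚ∑.*-distribʳ-∑ K C α) (ℚ∑.·-combinationʳ K b α (λ r → toℚ ∘ p r)) ⟩
    sumℚ K (λ r → α r ℚ.* C) ℚ.- sumℚ K (λ r → α r ℚ.* (B i ·ℚ (toℚ ∘ p r)))
      ≡⟨ ℚ∑.∑-distrib-sub K _ _ ⟨
    sumℚ K (λ r → α r ℚ.* C ℚ.- α r ℚ.* (B i ·ℚ (toℚ ∘ p r)))
      ≡⟨ ℚ∑.∑-cong K (λ r → trans (solve 3 (λ a C X → a :* C :- a :* X := a :* (C :- X)) refl (α r) C _)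
                                   (cong (α r ℚ.*_) (slackℚ-toℚ (p r) i))) ⟩
    sumℚ K (λ r → α r ℚ.* toℚ (slack B c (p r) i)) ∎
    where
    open ≡-Reasoning
    open +-*-Solver
    C = toℚ (c i)
    b = toℚ ∘ B i

  InQ⇒InP : ∀ x → InQ B c x → InP B c x
  InQ⇒InP x (K , p , α , p∈P , 0≤α , ∑α≡1 , x≡) = 0≤slackℚ⇒InP x (λ i →
    subst (0ℚ ℚ.≤_) (sym (slackℚ-convex α p ∑α≡1 x≡ i))
          (∑-nonNeg K (λ r → *-nonNeg (0≤α r) (toℚ-mono-≤ (InPℤ⇒0≤slack (p r) (p∈P r) i)))))

  slackℚ-affine : ∀ t (x y : ℚ^ m) i →
    slackℚ B c (λ j → t ℚ.* x j ℚ.+ (1ℚ ℚ.- t) ℚ.* y j) i ≡ t ℚ.* slackℚ B c x i ℚ.+ (1ℚ ℚ.- t) ℚ.* slackℚ B c y i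
  slackℚ-affine t x y i = begin
    C ℚ.- b ℚ∑.· (λ j → t ℚ.* x j ℚ.+ (1ℚ ℚ.- t) ℚ.* y j)
      ≡⟨ cong (λ a → C ℚ.- a) (trans (ℚ∑.·-distribˡ-+ b _ _) (cong₂ ℚ._+_ (ℚ∑.·-*ʳ t b x) (ℚ∑.·-*ʳ (1ℚ ℚ.- t) b y))) ⟩
    C ℚ.- (t ℚ.* (b ℚ∑.· x) ℚ.+ (1ℚ ℚ.- t) ℚ.* (b ℚ∑.· y))
      ≡⟨ solve 4 (λ C t X Y → C :- (t :* X :+ (con 1ℚ :- t) :* Y) := t :* (C :- X) :+ (con 1ℚ :- t) :* (C :- Y))
               refl C t (b ℚ∑.· x) (b ℚ∑.· y) ⟩
    t ℚ.* (C ℚ.- b ℚ∑.· x) ℚ.+ (1ℚ ℚ.- t) ℚ.* (C ℚ.- b ℚ∑.· y) ∎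
    where
    open ≡-Reasoning
    open +-*-Solver
    C = toℚ (c i)
    b = toℚ ∘ B i

  slack-dilation : ∀ k z i → slack B (λ i → k ℤ.* c i) (λ j → k ℤ.* z j) i ≡ k ℤ.* slack B c z i
  slack-dilation k z i = begin
    k ℤ.* c i ℤ.- B i ·ℤ (λ j → k ℤ.* z j) ≡⟨ cong (λ a → k ℤ.* c i ℤ.- a) (ℤ∑.·-*ʳ k (B i) z) ⟩
    k ℤ.* c i ℤ.- k ℤ.* (B i ·ℤ z)         ≡⟨ distrib k (c i) (B i ·ℤ z) ⟩
    k ℤ.* (c i ℤ.- B i ·ℤ z)               ∎
    where
    open ≡-Reasoning
    distrib : ∀ k a b → k ℤ.* a ℤ.- k ℤ.* b ≡ k ℤ.* (a ℤ.- b)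
    distrib = ℤ-Solver.solve-∀

  slackℚ-contraction : ∀ k ν (p : ℤ^ m) → ν ℚ.* toℚ k ≡ 1ℚ →
    ∀ i → slackℚ B c (λ j → ν ℚ.* toℚ (p j)) i ≡ ν ℚ.* toℚ (slack B (λ i → k ℤ.* c i) p i)
  slackℚ-contraction k ν p ν*k≡1 i = begin
    C ℚ.- b ℚ∑.· (λ j → ν ℚ.* toℚ (p j))     ≡⟨ cong (λ a → C ℚ.- a) (ℚ∑.·-*ʳ ν b (toℚ ∘ p)) ⟩
    C ℚ.- ν ℚ.* P                           ≡⟨ cong (λ a → a ℚ.- ν ℚ.* P) (ℚP.*-identityˡ C) ⟨
    1ℚ ℚ.* C ℚ.- ν ℚ.* P                    ≡⟨ cong (λ a → a ℚ.* C ℚ.- ν ℚ.* P) ν*k≡1 ⟨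
    ν ℚ.* toℚ k ℚ.* C ℚ.- ν ℚ.* P           ≡⟨ solve 4 (λ ν k C P → ν :* k :* C :- ν :* P := ν :* (k :* C :- P)) refl ν (toℚ k) C P ⟩
    ν ℚ.* (toℚ k ℚ.* C ℚ.- P)               ≡⟨ cong (ν ℚ.*_) (cong₂ ℚ._-_ (toℚ-* k (c i)) (toℚ-· (B i) p)) ⟨
    ν ℚ.* (toℚ (k ℤ.* c i) ℚ.- toℚ (B i ·ℤ p)) ≡⟨ cong (ν ℚ.*_) (toℚ-sub (k ℤ.* c i) (B i ·ℤ p)) ⟨
    ν ℚ.* toℚ (k ℤ.* c i ℤ.- B i ·ℤ p)      ∎
    where
    open ≡-Reasoning
    open +-*-Solver
    C = toℚ (c i)
    b = toℚ ∘ B i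
    P = b ℚ∑.· (toℚ ∘ p)

expo-cong : ∀ {n m} (B : Config n m) c {y z} → (∀ j → y j ≡ z j) → ∀ i → expo B c y i ≡ expo B c z i
expo-cong {m = m} B c y≡z i = cong (λ a → ℤ.∣ c i ℤ.- a ∣) (ℤ∑.∑-cong m (λ j → cong (B i j ℤ.*_) (y≡z j)))

InQ⇒latticePoint : ∀ {n m} (B : Config n m) c x → InQ B c x → ∃ λ z → InPℤ B c z
InQ⇒latticePoint B c x (zero  , _ , _ , _   , _ , ∑α≡1 , _) = ⊥-elim (ℚP.1≢0 (sym ∑α≡1))
InQ⇒latticePoint B c x (suc _ , p , _ , p∈P , _ , _    , _) = p zero , p∈P zero

Generates⇒trivialKernel : ∀ {n m} {B : Config n m} → Generates B →
                          ∀ δ → (∀ i → B i ·ℤ δ ≡ + 0) → ∀ j → δ j ≡ + 0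
Generates⇒trivialKernel {n} {m} {B} gen δ Bδ≡0 j with gen (ℤ∑.basis j)
... | λs , basis≡λsB = begin
  δ j                                          ≡⟨ ℤ∑.basis-· j δ ⟨
  ℤ∑.basis j ·ℤ δ                              ≡⟨ ℤ∑.∑-cong m (λ j′ → cong (ℤ._* δ j′) (basis≡λsB j′)) ⟩
  (λ j′ → sumℤ n (λ i → λs i ℤ.* B i j′)) ·ℤ δ ≡⟨ ℤ∑.·-combinationˡ n λs B δ ⟩
  sumℤ n (λ i → λs i ℤ.* (B i ·ℤ δ))           ≡⟨ ℤ∑.∑-cong n (λ i → cong (λs i ℤ.*_) (Bδ≡0 i)) ⟩
  sumℤ n (λ i → λs i ℤ.* + 0)                  ≡⟨ ℤ∑.*-distribʳ-∑ n (+ 0) λs ⟨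
  sumℤ n λs ℤ.* + 0                            ≡⟨ ℤP.*-zeroʳ (sumℤ n λs) ⟩
  + 0                                          ∎
  where open ≡-Reasoning

module GaleDuality {n m} (B : Config n m) (A : Config n (n ∸ m)) (gale : GaleDual B A) where

  deg-difference : ∀ (u v : ℕ^ n) k → sumℤ n (λ i → (+ u i ℤ.- + v i) ℤ.* A i k) ≡ deg A u k ℤ.- deg A v k
  deg-difference u v k = ℤ∑.·-distribʳ-sub (+_ ∘ u) (+_ ∘ v) (λ i → A i k)

  sameDegree⇒rowSpan : ∀ {u v} → (∀ k → deg A u k ≡ deg A v k) → ∃ λ w → ∀ i → + u i ℤ.- + v i ≡ B i ·ℤ w
  sameDegree⇒rowSpan {u} {v} deg≡ =
    proj₁ (gale (λ i → + u i ℤ.- + v i)) (λ k → trans (deg-difference u v k) (ℤP.i≡j⇒i-j≡0 (deg≡ k)))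

  rowSpan⇒sameDegree : ∀ {u v} w → (∀ i → + u i ℤ.- + v i ≡ B i ·ℤ w) → ∀ k → deg A u k ≡ deg A v k
  rowSpan⇒sameDegree {u} {v} w u-v≡Bw k =
    ℤP.i-j≡0⇒i≡j _ _ (trans (sym (deg-difference u v k)) (proj₂ (gale (λ i → + u i ℤ.- + v i)) (w , u-v≡Bw) k))

  sameDegree⇒slack : ∀ c z₀ (e₀ u : ℕ^ n) → (∀ i → + e₀ i ≡ slack B c z₀ i) → (∀ k → deg A u k ≡ deg A e₀ k) →
            ∃ λ z → ∀ i → slack B c z i ≡ + u i
  sameDegree⇒slack c z₀ e₀ u e₀≡slack deg≡ =
    let w , u-e₀≡Bw = sameDegree⇒rowSpan {u} {e₀} deg≡
    in (λ j → z₀ j ℤ.- w j) , λ i → begin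
    c i ℤ.- B i ·ℤ (λ j → z₀ j ℤ.- w j)   ≡⟨ cong (λ a → c i ℤ.- a) (ℤ∑.·-distribˡ-sub (B i) z₀ w) ⟩
    c i ℤ.- (B i ·ℤ z₀ ℤ.- B i ·ℤ w)      ≡⟨ regroup (c i) (B i ·ℤ z₀) (B i ·ℤ w) ⟩
    slack B c z₀ i ℤ.+ B i ·ℤ w           ≡⟨ cong₂ ℤ._+_ (e₀≡slack i) (u-e₀≡Bw i) ⟨
    + e₀ i ℤ.+ (+ u i ℤ.- + e₀ i)         ≡⟨ cancel (+ e₀ i) (+ u i) ⟩
    + u i                                 ∎
    where
    open ≡-Reasoning
    regroup : ∀ c z w → c ℤ.- (z ℤ.- w) ≡ (c ℤ.- z) ℤ.+ w
    regroup = ℤ-Solver.solve-∀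
    cancel : ∀ e u → e ℤ.+ (u ℤ.- e) ≡ u
    cancel = ℤ-Solver.solve-∀

Standard : ∀ {n} → MonomialIdeal n → ℕ^ n → Set
Standard M u = ¬ (_∈M M u)

standard-downward : ∀ {n} (M : MonomialIdeal n) {u v} → Standard M v → (∀ i → u i ℕ.≤ v i) → Standard M u
standard-downward M {u} {v} v-std u≤v u∈M = v-std (closed M u v u≤v u∈M)

module StandardMonomials {n m} (B : Config n m) (A : Config n (n ∸ m)) (M : MonomialIdeal n)
  (gen : Generates B) (gale : GaleDual B A) (virt : VirtualInitial A M) where

  open GaleDuality B A gale

  standard-unique : ∀ c z → InPℤ B c z → Standard M (expo B c z) → ∀ y → InPℤ B c y →
                    ∀ u → Standard M u → (∀ i → expo B c y i ℕ.≤ u i) → ∀ j → y j ≡ z j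
  standard-unique c z z∈P z-std y y∈P u u-std y≤u j =
    sym (ℤP.i-j≡0⇒i≡j (z j) (y j) (Generates⇒trivialKernel gen (λ j → z j ℤ.- y j) B[z-y]≡0 j))
    where
    a = expo B c y
    b = expo B c z
    v₁ v₂ : ℕ^ n
    v₁ i = a i ∸ b i
    v₂ i = b i ∸ a i
    v₁-v₂≡B[z-y] : ∀ i → + v₁ i ℤ.- + v₂ i ≡ B i ·ℤ (λ j → z j ℤ.- y j)
    v₁-v₂≡B[z-y] i = begin
      + v₁ i ℤ.- + v₂ i                  ≡⟨ [m∸n]-[n∸m]≡m-n (a i) (b i) ⟩
      + a i ℤ.- + b i                    ≡⟨ cong₂ ℤ._-_ (expo≡slack B c y y∈P i) (expo≡slack B c z z∈P i) ⟩
      slack B c y i ℤ.- slack B c z i    ≡⟨ cancel (c i) (B i ·ℤ y) (B i ·ℤ z) ⟩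
      B i ·ℤ z ℤ.- B i ·ℤ y              ≡⟨ ℤ∑.·-distribˡ-sub (B i) z y ⟨
      B i ·ℤ (λ j → z j ℤ.- y j)         ∎
      where
      open ≡-Reasoning
      cancel : ∀ c y z → (c ℤ.- y) ℤ.- (c ℤ.- z) ≡ z ℤ.- y
      cancel = ℤ-Solver.solve-∀
    -- v₁ and v₂ are standard (v₁ ≤ u, v₂ ≤ b) and have the same degree.
    v₁≡v₂ : ∀ i → v₁ i ≡ v₂ i
    v₁≡v₂ i = trans (unique v₁ (rowSpan⇒sameDegree {v₁} {v₂} (λ j → z j ℤ.- y j) v₁-v₂≡B[z-y]) v₁-std i)
                    (sym (unique v₂ (λ _ → refl) v₂-std i))
      where
      unique = proj₂ (proj₂ (virt (deg A v₂) (v₂ , λ _ → refl)))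
      v₁-std = standard-downward M u-std (λ i → ℕP.≤-trans (ℕP.m∸n≤m (a i) (b i)) (y≤u i))
      v₂-std = standard-downward M z-std (λ i → ℕP.m∸n≤m (b i) (a i))
    B[z-y]≡0 : ∀ i → B i ·ℤ (λ j → z j ℤ.- y j) ≡ + 0
    B[z-y]≡0 i = trans (sym (v₁-v₂≡B[z-y] i))
                       (trans (cong (λ v → + v ℤ.- + v₂ i) (v₁≡v₂ i)) (ℤP.+-inverseʳ (+ v₂ i)))

  standard-exists : ∀ c z₀ → InPℤ B c z₀ → ∃ λ z → InPℤ B c z × Standard M (expo B c z)
  standard-exists c z₀ z₀∈P =
    let u , (deg≡ , u-std) , _ = virt (deg A (expo B c z₀)) (expo B c z₀ , λ _ → refl)
        z , slack≡u = sameDegree⇒slack c z₀ (expo B c z₀) u (expo≡slack B c z₀ z₀∈P) deg≡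
    in z , 0≤slack⇒InPℤ B c z (λ i → subst (+ 0 ℤ.≤_) (sym (slack≡u i)) (ℤ.+≤+ ℕ.z≤n))
         , standard-downward M u-std (λ i → ℕP.≤-reflexive (cong ℤ.∣_∣ (slack≡u i)))

-- The standard point is a vertex

module Vertex {n m} (B : Config n m) (A : Config n (n ∸ m)) (M : MonomialIdeal n)
  (gen : Generates B) (gale : GaleDual B A) (virt : VirtualInitial A M)
  (c : ℤ^ n) (P⊆Q : ∀ x → InP B c x → InQ B c x) where

  open StandardMonomials B A M gen gale virt

  dilation-standard-point : ∀ z → InPℤ B c z → ∀ k →
    ∃ λ p → InPℤ B (λ i → + k ℤ.* c i) p × Standard M (expo B (λ i → + k ℤ.* c i) p)
  dilation-standard-point z z∈P k = standard-exists Nc Nz (0≤slack⇒InPℤ B Nc Nz λ i →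
    subst (+ 0 ℤ.≤_) (slack≡ i) (ℤ.+≤+ ℕ.z≤n))
    where
    Nc = λ i → + k ℤ.* c i
    Nz = λ j → + k ℤ.* z j
    slack≡ : ∀ i → + (k ℕ.* expo B c z i) ≡ slack B Nc Nz i
    slack≡ i = trans (ℤP.pos-* k (expo B c z i))
                     (trans (cong (+ k ℤ.*_) (expo≡slack B c z z∈P i)) (sym (slack-dilation B c (+ k) z i)))

  slack-dominated⇒≡ : ∀ z → InPℤ B c z → Standard M (expo B c z) → ∀ y → InPℤ B c y →
                ∀ D → (∀ i → expo B c y i ℕ.≤ D ℕ.* expo B c z i) → ∀ j → y j ≡ z j
  slack-dominated⇒≡ z z∈P z-std y y∈P D y≤Dz = conclude (P⊆Q q q∈P)
    where
    -- suc N reduces to (1 + D)(1 + n).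
    N = n ℕ.+ D ℕ.* suc n
    ν = 1/suc N
    Nc : ℤ^ n
    Nc i = + suc N ℤ.* c i
    dilation = dilation-standard-point z z∈P (suc N)
    p = proj₁ dilation
    p∈P = proj₁ (proj₂ dilation)
    u = expo B Nc p
    u-std = proj₂ (proj₂ dilation)
    q : ℚ^ m
    q j = ν ℚ.* toℚ (p j)
    slack-q : ∀ i → slackℚ B c q i ≡ ν ℚ.* toℚ (+ u i)
    slack-q i = trans (slackℚ-contraction B c (+ suc N) ν p (1/suc-inverse N) i)
                      (cong (λ a → ν ℚ.* toℚ a) (sym (expo≡slack B Nc p p∈P i)))
    q∈P : InP B c q
    q∈P = 0≤slackℚ⇒InP B c q (λ i → subst (0ℚ ℚ.≤_) (sym (slack-q i)) (*-nonNeg (0≤1/suc N) (0≤toℚ-ℕ (u i))))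
    conclude : InQ B c q → ∀ j → y j ≡ z j
    conclude (K , ys , μ , ys∈P , 0≤μ , ∑μ≡1 , q≡) =
      standard-unique c z z∈P z-std y y∈P u u-std (λ i → m*[1+n]≤n*[1+o]⇒m≤o _ n _ (ℕP.≤-trans
        (m≤d*e⇒m*[1+n]≤e*[[1+d]*[1+n]] _ D _ n (y≤Dz i))
        (subst (λ e → e ℕ.* suc N ℕ.≤ n ℕ.* suc (u i)) (expo-cong B c ys-r≡z i) (close i))))
      where
      T : Fin K → ℕ^ n
      T r = expo B c (ys r)
      ∑μT≡ : ∀ i → sumℚ K (λ r → μ r ℚ.* toℚ (+ T r i)) ≡ ν ℚ.* toℚ (+ u i)
      ∑μT≡ i = begin
        sumℚ K (λ r → μ r ℚ.* toℚ (+ T r i))               ≡⟨ ℚ∑.∑-cong K (λ r → cong (λ a → μ r ℚ.* toℚ a) (expo≡slack B c (ys r) (ys∈P r) i)) ⟩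
        sumℚ K (λ r → μ r ℚ.* toℚ (slack B c (ys r) i))    ≡⟨ slackℚ-convex B c μ ys ∑μ≡1 q≡ i ⟨
        slackℚ B c q i                                     ≡⟨ slack-q i ⟩
        ν ℚ.* toℚ (+ u i)                                  ∎
        where open ≡-Reasoning
      r = proj₁ (small-point-of-convex-combination n N μ T u 0≤μ ∑μ≡1 ∑μT≡)
      close : ∀ i → T r i ℕ.* suc N ℕ.≤ n ℕ.* suc (u i)
      close = proj₂ (small-point-of-convex-combination n N μ T u 0≤μ ∑μ≡1 ∑μT≡)
      ys-r≡z : ∀ j → ys r j ≡ z j
      ys-r≡z = standard-unique c z z∈P z-std (ys r) (ys∈P r) u u-std (λ i → m*[1+n]≤n*[1+o]⇒m≤o _ n _
        (ℕP.≤-trans (ℕP.*-monoʳ-≤ (T r i) (ℕP.m≤n*m (suc n) (suc D))) (close i)))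

  slackℚ-dominated⇒≡ : ∀ z → InPℤ B c z → Standard M (expo B c z) → ∀ x → InQ B c x →
    ∀ κ → 0ℚ ℚ.< κ → (∀ i → κ ℚ.* slackℚ B c x i ℚ.≤ toℚ (slack B c z i)) → ∀ j → x j ≡ toℚ (z j)
  slackℚ-dominated⇒≡ z z∈P z-std x (K , p , α , p∈P , 0≤α , ∑α≡1 , x≡) κ 0<κ κx≤z j =
    trans (x≡ j) (trans (∑-concentrated K α _ (toℚ (z j)) 0≤α (λ r 0<α → cong toℚ (p≡z r 0<α j)))
                        (trans (cong (ℚ._* toℚ (z j)) ∑α≡1) (ℚP.*-identityˡ (toℚ (z j)))))
    where
    p≡z : ∀ r → 0ℚ ℚ.< α r → ∀ j → p r j ≡ z j
    p≡z r 0<α = slack-dominated⇒≡ z z∈P z-std (p r) (p∈P r) D bound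
      where
      D = proj₁ (archimedean (κ ℚ.* α r) (*-pos 0<κ 0<α))
      bound : ∀ i → expo B c (p r) i ℕ.≤ D ℕ.* expo B c z i
      bound i = toℚ-ℕ-cancel-≤ (begin
        e
          ≡⟨ ℚP.*-identityˡ e ⟨
        1ℚ ℚ.* e
          ≤⟨ *-monoʳ-≤-nonNeg (0≤toℚ-ℕ (expo B c (p r) i)) (proj₂ (archimedean (κ ℚ.* α r) (*-pos 0<κ 0<α))) ⟩
        toℚ (+ D) ℚ.* (κ ℚ.* α r) ℚ.* e
          ≡⟨ solve 4 (λ D κ α e → D :* (κ :* α) :* e := D :* (κ :* (α :* e))) refl (toℚ (+ D)) κ (α r) e ⟩
        toℚ (+ D) ℚ.* (κ ℚ.* (α r ℚ.* e))
          ≤⟨ *-monoˡ-≤-nonNeg (0≤toℚ-ℕ D) (ℚP.≤-trans (*-monoˡ-≤-nonNeg (ℚP.<⇒≤ 0<κ) αe≤x) (κx≤z i)) ⟩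
        toℚ (+ D) ℚ.* toℚ (slack B c z i)
          ≡⟨ cong (λ a → toℚ (+ D) ℚ.* toℚ a) (expo≡slack B c z z∈P i) ⟨
        toℚ (+ D) ℚ.* toℚ (+ expo B c z i)
          ≡⟨ toℚ-ℕ-* D (expo B c z i) ⟨
        toℚ (+ (D ℕ.* expo B c z i))
          ∎)
        where
        open ℚP.≤-Reasoning
        open +-*-Solver
        e = toℚ (+ expo B c (p r) i)
        αe : Fin K → ℚ
        αe r = α r ℚ.* toℚ (+ expo B c (p r) i)
        αe≤x : α r ℚ.* e ℚ.≤ slackℚ B c x i
        αe≤x = ℚP.≤-trans (term≤∑ K {αe} (λ r → *-nonNeg (0≤α r) (0≤toℚ-ℕ (expo B c (p r) i))) r) (ℚP.≤-reflexive (trans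
          (ℚ∑.∑-cong K (λ r → cong (λ a → α r ℚ.* toℚ a) (expo≡slack B c (p r) (p∈P r) i)))
          (sym (slackℚ-convex B c α p ∑α≡1 x≡ i))))

  standard-vertex : ∀ z → InPℤ B c z → Standard M (expo B c z) → VertexQ B c (toℚ ∘ z)
  standard-vertex z z∈P z-std = P⊆Q (toℚ ∘ z) z∈P , endpoints-equal
    where
    endpoints-equal : ∀ x y t → InQ B c x → InQ B c y → 0ℚ ℚ.< t → t ℚ.< 1ℚ →
                      (∀ j → toℚ (z j) ≡ t ℚ.* x j ℚ.+ (1ℚ ℚ.- t) ℚ.* y j) → ∀ j → x j ≡ y j
    endpoints-equal x y t x∈Q y∈Q 0<t t<1 z≡ j = trans (x≡z j) (sym (y≡z j))
      where
      0<1-t = p<q⇒0<q-p t<1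
      0≤slack-x = InP⇒0≤slackℚ B c x (InQ⇒InP B c x x∈Q)
      0≤slack-y = InP⇒0≤slackℚ B c y (InQ⇒InP B c y y∈Q)
      slack-z≡ : ∀ i → toℚ (slack B c z i) ≡ t ℚ.* slackℚ B c x i ℚ.+ (1ℚ ℚ.- t) ℚ.* slackℚ B c y i
      slack-z≡ i = begin
        toℚ (slack B c z i)     ≡⟨ slackℚ-toℚ B c z i ⟨
        slackℚ B c (toℚ ∘ z) i  ≡⟨ cong (λ a → toℚ (c i) ℚ.- a) (ℚ∑.∑-cong m (λ j → cong (toℚ (B i j) ℚ.*_) (z≡ j))) ⟩
        slackℚ B c (λ j → t ℚ.* x j ℚ.+ (1ℚ ℚ.- t) ℚ.* y j) i ≡⟨ slackℚ-affine B c t x y i ⟩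
        t ℚ.* slackℚ B c x i ℚ.+ (1ℚ ℚ.- t) ℚ.* slackℚ B c y i ∎
        where open ≡-Reasoning
      x≡z = slackℚ-dominated⇒≡ z z∈P z-std x x∈Q t 0<t (λ i →
        subst (_ ℚ.≤_) (sym (slack-z≡ i)) (p≤p+q _ (*-nonNeg (ℚP.<⇒≤ 0<1-t) (0≤slack-y i))))
      y≡z = slackℚ-dominated⇒≡ z z∈P z-std y y∈Q (1ℚ ℚ.- t) 0<1-t (λ i →
        subst (_ ℚ.≤_) (sym (slack-z≡ i)) (q≤p+q _ (*-nonNeg (ℚP.<⇒≤ 0<t) (0≤slack-x i))))

lemma6p5 : ∀ (n m : ℕ) (B : Config n m) (A : Config n (n ∸ m)) (M : MonomialIdeal n)
    (c : ℤ^ n) →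
    Generates B → GaleDual B A → VirtualInitial A M →
    (∃ λ (x : ℚ^ m) → InP B c x) →
    (∀ (x : ℚ^ m) → (InP B c x → InQ B c x) × (InQ B c x → InP B c x)) →
    ∃ λ (z : ℤ^ m) → (InPℤ B c z × ¬ (_∈M M (expo B c z)))
    × (∀ (z' : ℤ^ m) → InPℤ B c z' → ¬ (_∈M M (expo B c z')) → ∀ j → z' j ≡ z j)
    × VertexQ B c (λ j → toℚ (z j))
lemma6p5 n m B A M c gen gale virt (x₀ , x₀∈P) P⇔Q =
  let z₀ , z₀∈P = InQ⇒latticePoint B c x₀ (proj₁ (P⇔Q x₀) x₀∈P)
      z , z∈P , z-std = standard-exists c z₀ z₀∈P
  in z , (z∈P , z-std)
       , (λ z′ z′∈P z′-std → standard-unique c z z∈P z-std z′ z′∈P (expo B c z′) z′-std (λ _ → ℕP.≤-refl))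
       , standard-vertex z z∈P z-std
  where
  open StandardMonomials B A M gen gale virt
  open Vertex B A M gen gale virt c (λ x → proj₁ (P⇔Q x))
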